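{- For all $k,n\in\mathbb{N}^+$, we have $k^2\, b(n)\ge b(kn)$, where $b(m)$ is the minimum number such that every temporal bi-clique with $m$ vertices on each side admits a bi-spanner with at most $b(m)$ edges.
   Context: A temporal bi-clique $(A,B,\lambda)$ is the complete bipartite graph with disjoint parts $A,B$ together with a labeling $\lambda$ of its edges by natural numbers. A path $v_1\dots v_k$ is temporal if $\lambda(\{v_i,v_{i+1}\})\le\lambda(\{v_{i+1},v_{i+2}\})$ for all $i\in[k-2]$. A bi-spanner is an edge set $S$ such that every $a\in A$ reaches every $b\in B$ by a temporal path using only edges of $S$. -}

module Defs where

open import Data.Nat using (ℕ; _≤_; _+_)
open import Data.Fin using (Fin)
open import Data.Bool using (Bool; true; false; if_then_else_)
open import Data.Sum using (_⊎_; inj₁; inj₂)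
open import Data.Product using (Σ; _×_; ∃)
open import Data.Empty using (⊥)
open import Data.Maybe using (Maybe; just)
open import Data.List using (List; []; _∷_; head; last; map; allFin)
open import Data.Nat.ListAction using (sum)
open import Data.List.Relation.Unary.Unique.Propositional using (Unique)
open import Relation.Binary.PropositionalEquality using (_≡_)

-- A temporal bi-clique with m vertices on each side:
-- A = Fin m (vertices inj₁ a), B = Fin m (vertices inj₂ b);
-- the edge {a,b} of the complete bipartite graph is labelled by  lab a b.
Labeling : ℕ → Set
Labeling m = Fin m → Fin m → ℕ

Vertex : ℕ → Set
Vertex m = Fin m ⊎ Fin m

EdgeSet : ℕ → Set
EdgeSet m = Fin m → Fin m → Bool

size : ∀ {m} → EdgeSet m → ℕ
size {m} S = sum (map (λ a → sum (map (λ b → if S a b then 1 else 0) (allFin m))) (allFin m))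

Adj : ∀ {m} → EdgeSet m → Vertex m → Vertex m → Set
Adj S (inj₁ a) (inj₂ b) = S a b ≡ true
Adj S (inj₂ b) (inj₁ a) = S a b ≡ true
Adj S (inj₁ _) (inj₁ _) = ⊥
Adj S (inj₂ _) (inj₂ _) = ⊥

-- label of the (bipartite) edge between two vertices (irrelevant for non-edges)
labOf : ∀ {m} → Labeling m → Vertex m → Vertex m → ℕ
labOf lab (inj₁ a) (inj₂ b) = lab a b
labOf lab (inj₂ b) (inj₁ a) = lab a b
labOf lab (inj₁ _) (inj₁ _) = 0
labOf lab (inj₂ _) (inj₂ _) = 0

data TemporalWalk {m} (S : EdgeSet m) (lab : Labeling m) : List (Vertex m) → Set where
  single : ∀ {v} → TemporalWalk S lab (v ∷ [])
  edge   : ∀ {u v} → Adj S u v → TemporalWalk S lab (u ∷ v ∷ [])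
  step   : ∀ {u v w rest} → Adj S u v → labOf lab u v ≤ labOf lab v w →
           TemporalWalk S lab (v ∷ w ∷ rest) → TemporalWalk S lab (u ∷ v ∷ w ∷ rest)

TemporalPath : ∀ {m} → EdgeSet m → Labeling m → Fin m → Fin m → List (Vertex m) → Set
TemporalPath S lab a b vs =
  TemporalWalk S lab vs × Unique vs ×
  head vs ≡ just (inj₁ a) × last vs ≡ just (inj₂ b)

BiSpanner : ∀ {m} → Labeling m → EdgeSet m → Set
BiSpanner {m} lab S = (a b : Fin m) → ∃ λ vs → TemporalPath S lab a b vs

AdmitsBound : ℕ → ℕ → Set
AdmitsBound m c = (lab : Labeling m) → Σ (EdgeSet m) λ S → BiSpanner lab S × size S ≤ c

IsB : ℕ → ℕ → Set
IsB m c = AdmitsBound m c × (∀ c' → AdmitsBound m c' → c ≤ c')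

-- Split each side of a temporal bi-clique with k·n vertices per side into k blocks of n
-- vertices. Each of the k² pairs (A-block, B-block) induces a temporal bi-clique with n
-- vertices per side, which has a bi-spanner with at most b(n) edges. The union of these
-- k² spanners is a bi-spanner of the whole bi-clique: a ∈ A and b ∈ B lie in one pair of
-- blocks, and a temporal path inside that pair stays temporal in the big bi-clique, since
-- the induced labeling is the restriction of the original one.
module Submission where

open import Data.Bool using (Bool; true; if_then_else_)
open import Data.Fin using (Fin; zero; suc; _↑ˡ_; _↑ʳ_; combine; remQuot)
open import Data.Fin.Properties using (remQuot-combine; combine-remQuot; combine-injectiveʳ)
open import Data.List using (map; allFin; tabulate)
open import Data.List.Properties using (map-tabulate; head-map; last-map)
open import Data.List.Relation.Unary.Unique.Propositional.Properties using (map⁺)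
import Data.Maybe as Maybe
open import Data.Nat using (ℕ; _+_; _*_; _≤_; _≥_; z≤n)
import Data.Nat.ListAction as List
open import Data.Nat.Properties
  using (+-assoc; +-mono-≤; *-assoc; +-0-commutativeMonoid; module ≤-Reasoning)
open import Algebra.Properties.CommutativeMonoid.Sum +-0-commutativeMonoid
  using (sum; sum-syntax; ∑-comm; sum-cong-≗)
open import Data.Product using (_×_; _,_; ∃; proj₁; proj₂)
open import Data.Sum using (inj₁; inj₂)
import Data.Sum as Sum
open import Data.Sum.Properties using (inj₁-injective; inj₂-injective)
open import Function using (_∘_; id; Injective)
open import Relation.Binary.PropositionalEquality

open import Defs

∑-allFin : ∀ {m} (f : Fin m → ℕ) → List.sum (map f (allFin m)) ≡ ∑[ i < m ] f i
∑-allFin {m} f = trans (cong List.sum (map-tabulate id f)) (sum-tabulate f)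
  where
  sum-tabulate : ∀ {m} (f : Fin m → ℕ) → List.sum (tabulate f) ≡ ∑[ i < m ] f i
  sum-tabulate {ℕ.zero} f = refl
  sum-tabulate {ℕ.suc m} f = cong (f zero +_) (sum-tabulate (f ∘ suc))

∑-↑ : ∀ m n (f : Fin (m + n) → ℕ) →
      ∑[ i < m + n ] f i ≡ ∑[ i < m ] f (i ↑ˡ n) + ∑[ j < n ] f (m ↑ʳ j)
∑-↑ ℕ.zero n f = refl
∑-↑ (ℕ.suc m) n f = trans (cong (f zero +_) (∑-↑ m n (f ∘ suc))) (sym (+-assoc (f zero) _ _))

∑-combine : ∀ m n (f : Fin (m * n) → ℕ) →
            ∑[ a < m * n ] f a ≡ ∑[ i < m ] ∑[ x < n ] f (combine i x)
∑-combine ℕ.zero n f = refl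
∑-combine (ℕ.suc m) n f =
  trans (∑-↑ n (m * n) f) (cong (∑[ x < n ] f (combine {ℕ.suc m} zero x) +_) (∑-combine m n (f ∘ (n ↑ʳ_))))

∑-≤ : ∀ {n} (f : Fin n → ℕ) {c} → (∀ i → f i ≤ c) → ∑[ i < n ] f i ≤ n * c
∑-≤ {ℕ.zero} f bound = z≤n
∑-≤ {ℕ.suc n} f bound = +-mono-≤ (bound zero) (∑-≤ (f ∘ suc) (bound ∘ suc))

size≡∑∑ : ∀ {m} (S : EdgeSet m) → size S ≡ ∑[ a < m ] ∑[ b < m ] (if S a b then 1 else 0)
size≡∑∑ {m} S = trans (∑-allFin {m} _) (sum-cong-≗ {m} (λ a → ∑-allFin {m} _))

Sum-map-injective : ∀ {A B C D : Set} {f : A → B} {g : C → D} →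
                    Injective _≡_ _≡_ f → Injective _≡_ _≡_ g → Injective _≡_ _≡_ (Sum.map f g)
Sum-map-injective f-inj g-inj {inj₁ a} {inj₁ a′} eq = cong inj₁ (f-inj (inj₁-injective eq))
Sum-map-injective f-inj g-inj {inj₂ b} {inj₂ b′} eq = cong inj₂ (g-inj (inj₂-injective eq))

module _ {n m} {S : EdgeSet n} {lab : Labeling n} {S′ : EdgeSet m} {lab′ : Labeling m}
         (f g : Fin n → Fin m)
         (edge-preserved : ∀ a b → S a b ≡ true → S′ (f a) (g b) ≡ true)
         (label-preserved : ∀ a b → lab′ (f a) (g b) ≡ lab a b) where

  Adj-embed : ∀ u v → Adj S u v → Adj S′ (Sum.map f g u) (Sum.map f g v)
  Adj-embed (inj₁ a) (inj₂ b) = edge-preserved a b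
  Adj-embed (inj₂ b) (inj₁ a) = edge-preserved a b

  labOf-embed : ∀ u v → labOf lab′ (Sum.map f g u) (Sum.map f g v) ≡ labOf lab u v
  labOf-embed (inj₁ a) (inj₁ a′) = refl
  labOf-embed (inj₁ a) (inj₂ b) = label-preserved a b
  labOf-embed (inj₂ b) (inj₁ a) = label-preserved a b
  labOf-embed (inj₂ b) (inj₂ b′) = refl

  TemporalWalk-embed : ∀ {vs} → TemporalWalk S lab vs → TemporalWalk S′ lab′ (map (Sum.map f g) vs)
  TemporalWalk-embed single = single
  TemporalWalk-embed (edge {u} {v} uv) = edge (Adj-embed u v uv)
  TemporalWalk-embed (step {u} {v} {w} uv ≤vw walk) =
    step (Adj-embed u v uv)
         (subst₂ _≤_ (sym (labOf-embed u v)) (sym (labOf-embed v w)) ≤vw)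
         (TemporalWalk-embed walk)

  TemporalPath-embed : Injective _≡_ _≡_ f → Injective _≡_ _≡_ g → ∀ {a b vs} →
                       TemporalPath S lab a b vs → TemporalPath S′ lab′ (f a) (g b) (map (Sum.map f g) vs)
  TemporalPath-embed f-inj g-inj {vs = vs} (walk , unique , starts , ends) =
    TemporalWalk-embed walk ,
    map⁺ (Sum-map-injective f-inj g-inj) unique ,
    trans (head-map vs) (cong (Maybe.map (Sum.map f g)) starts) ,
    trans (last-map (Sum.map f g) vs) (cong (Maybe.map (Sum.map f g)) ends)

module _ {k n : ℕ} where

  blockLabeling : Labeling (k * n) → Fin k → Fin k → Labeling n
  blockLabeling lab i j x y = lab (combine i x) (combine j y)

  blockUnion : (Fin k → Fin k → EdgeSet n) → EdgeSet (k * n)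
  blockUnion T a b = onBlocks (remQuot n a) (remQuot n b)
    where
    onBlocks : Fin k × Fin n → Fin k × Fin n → Bool
    onBlocks (i , x) (j , y) = T i j x y

  blockUnion-combine : ∀ T i j x y → blockUnion T (combine i x) (combine j y) ≡ T i j x y
  blockUnion-combine T i j x y =
    cong₂ (λ (i , x) (j , y) → T i j x y) (remQuot-combine {k} {n} i x) (remQuot-combine {k} {n} j y)

  size-blockUnion : ∀ T → size (blockUnion T) ≡ ∑[ i < k ] ∑[ j < k ] size (T i j)
  size-blockUnion T = begin
    size (blockUnion T)
      ≡⟨ size≡∑∑ (blockUnion T) ⟩
    ∑[ a < k * n ] ∑[ b < k * n ] count (blockUnion T a b)
      ≡⟨ ∑-combine k n _ ⟩
    ∑[ i < k ] ∑[ x < n ] ∑[ b < k * n ] count (blockUnion T (combine i x) b)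
      ≡⟨ sum-cong-≗ {k} (λ i → sum-cong-≗ {n} (λ x → ∑-combine k n _)) ⟩
    ∑[ i < k ] ∑[ x < n ] ∑[ j < k ] ∑[ y < n ] count (blockUnion T (combine i x) (combine j y))
      ≡⟨ sum-cong-≗ {k} (λ i → sum-cong-≗ {n} (λ x → sum-cong-≗ {k} (λ j → sum-cong-≗ {n} (λ y →
           cong count (blockUnion-combine T i j x y))))) ⟩
    ∑[ i < k ] ∑[ x < n ] ∑[ j < k ] ∑[ y < n ] count (T i j x y)
      ≡⟨ sum-cong-≗ {k} (λ i → ∑-comm (λ x j → ∑[ y < n ] count (T i j x y))) ⟩
    ∑[ i < k ] ∑[ j < k ] ∑[ x < n ] ∑[ y < n ] count (T i j x y)
      ≡⟨ sum-cong-≗ {k} (λ i → sum-cong-≗ {k} (λ j → sym (size≡∑∑ (T i j)))) ⟩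
    ∑[ i < k ] ∑[ j < k ] size (T i j)
      ∎
    where
    open ≡-Reasoning
    count : Bool → ℕ
    count e = if e then 1 else 0

  blockUnion-biSpanner : ∀ lab T → (∀ i j → BiSpanner (blockLabeling lab i j) (T i j)) →
                         BiSpanner lab (blockUnion T)
  blockUnion-biSpanner lab T spanners a b =
    subst₂ (λ a b → ∃ (TemporalPath (blockUnion T) lab a b))
           (combine-remQuot {k} n a) (combine-remQuot {k} n b)
           (inBlocks (remQuot n a) (remQuot n b))
    where
    inBlocks : ∀ ((i , x) (j , y) : Fin k × Fin n) →
               ∃ (TemporalPath (blockUnion T) lab (combine i x) (combine j y))
    inBlocks (i , x) (j , y) =
      let vs , path = spanners i j x y in
      map (Sum.map (combine i) (combine j)) vs ,
      TemporalPath-embed (combine i) (combine j)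
        (λ x y → trans (blockUnion-combine T i j x y)) (λ _ _ → refl)
        (combine-injectiveʳ i _ i _) (combine-injectiveʳ j _ j _) path

AdmitsBound-* : ∀ k {n c} → AdmitsBound n c → AdmitsBound (k * n) (k * k * c)
AdmitsBound-* k {n} {c} admits lab = blockUnion T , blockUnion-biSpanner lab T isBiSpanner , bound
  where
  T : Fin k → Fin k → EdgeSet n
  T i j = proj₁ (admits (blockLabeling lab i j))

  isBiSpanner : ∀ i j → BiSpanner (blockLabeling lab i j) (T i j)
  isBiSpanner i j = proj₁ (proj₂ (admits (blockLabeling lab i j)))

  bound : size (blockUnion T) ≤ k * k * c
  bound = begin
    size (blockUnion T)                  ≡⟨ size-blockUnion T ⟩
    ∑[ i < k ] ∑[ j < k ] size (T i j)   ≤⟨ ∑-≤ {k} _ (λ i → ∑-≤ {k} _ (λ j → proj₂ (proj₂ (admits (blockLabeling lab i j))))) ⟩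
    k * (k * c)                          ≡⟨ *-assoc k k c ⟨
    k * k * c                            ∎
    where open ≤-Reasoning

lemma9 : (k n : ℕ) → k ≥ 1 → n ≥ 1 → (bn bkn : ℕ) → IsB n bn → IsB (k * n) bkn →
         bkn ≤ (k * k) * bn
lemma9 k n _ _ bn bkn (admits-bn , _) (_ , bkn-minimal) =
  bkn-minimal (k * k * bn) (AdmitsBound-* k admits-bn)
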